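{- If $G$ is a simple graph of order $n\ge2$ with $cc(G)$ connected components, then for every positive integer $t$ the graph $S[G,t]$ has $\frac{1}{n-1}\big(n^{t}(cc(G)-1)+n-cc(G)\big)$ connected components.
   Context: Let $G$ be a simple graph with vertex set $V=\{1,\dots,n\}$, $n\ge 2$. For $t\ge 1$, the generalized Sierpiński graph $S(G,t)$ has vertex set $V^t$ (words $u_1u_2\cdots u_t$ over $V$), and two words ${\bf u}=u_1\cdots u_t$, ${\bf v}=v_1\cdots v_t$ are adjacent iff there is $i\in\{1,\dots,t\}$ with $u_j=v_j$ for $j<i$, $u_i\neq v_i$ and $u_iv_i\in E(G)$, and $u_j=v_i$, $v_j=u_i$ for all $j>i$. An edge of this kind with $i<t$ is called a linking edge. The generalized Sierpiński gasket $S[G,t]$ is the graph obtained from $S(G,t)$ by contracting all linking edges (so $S[G,1]=G$). -}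

module Defs where

open import Level using (0ℓ)
open import Data.Nat using (ℕ; zero; suc)
open import Data.Fin using (Fin)
open import Data.Vec using (Vec; []; _∷_; replicate)
open import Data.Product using (Σ; ∃; _×_; _,_)
open import Data.Sum using (_⊎_)
open import Data.Empty using (⊥)
open import Relation.Nullary using (Dec; ¬_)
open import Relation.Binary.PropositionalEquality using (_≡_)
open import Relation.Binary.Construct.Closure.Equivalence using (EqClosure)
open import Function.Bundles using (_⇔_)

record SimpleGraph (n : ℕ) : Set₁ where
  field
    Adj    : Fin n → Fin n → Set
    adj?   : ∀ x y → Dec (Adj x y)
    sym    : ∀ {x y} → Adj x y → Adj y x
    irrefl : ∀ {x} → ¬ Adj x x

open SimpleGraph public

-- A graph whose vertices are the classes of a carrier type modulo a
-- relation _≈_ (identified vertices; the equivalence generated by _≈_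
-- is taken), with adjacency _—_ between representatives.
record QGraph : Set₁ where
  field
    Carrier : Set
    _≈_     : Carrier → Carrier → Set
    _—_     : Carrier → Carrier → Set

open QGraph public

Connected : (Γ : QGraph) → Carrier Γ → Carrier Γ → Set
Connected Γ = EqClosure (λ a b → _≈_ Γ a b ⊎ _—_ Γ a b)

-- Γ has exactly k connected components: the set of components is in
-- bijection with Fin k, i.e. there is a surjective labelling of vertices by
-- Fin k whose fibres are exactly the connected components.
NumComponents : QGraph → ℕ → Set
NumComponents Γ k =
  Σ (Carrier Γ → Fin k) λ f →
    (∀ (i : Fin k) → ∃ λ a → f a ≡ i) ×
    (∀ a b → (f a ≡ f b) ⇔ Connected Γ a b)

asQGraph : ∀ {n} → SimpleGraph n → QGraph
asQGraph {n} G = record { Carrier = Fin n ; _≈_ = _≡_ ; _—_ = Adj G }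

Word : ℕ → ℕ → Set
Word n t = Vec (Fin n) t

-- Edges of S(G,t), split by the position i of the first difference.
-- An edge at position i: common prefix, then u_i v_i ∈ E(G), and then
-- u_j = v_i, v_j = u_i for all j > i.
-- LinkEdge: edges with i < t (at least one letter after position i).
data LinkEdge {n : ℕ} (G : SimpleGraph n) : ∀ {t} → Word n t → Word n t → Set where
  here  : ∀ {m x y} → Adj G x y →
          LinkEdge G (x ∷ replicate (suc m) y) (y ∷ replicate (suc m) x)
  there : ∀ {t x} {u v : Word n t} → LinkEdge G u v → LinkEdge G (x ∷ u) (x ∷ v)

-- LastEdge: edges with i = t (the words differ only in the last letter).
data LastEdge {n : ℕ} (G : SimpleGraph n) : ∀ {t} → Word n t → Word n t → Set where
  last  : ∀ {x y} → Adj G x y → LastEdge G (x ∷ []) (y ∷ [])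
  there : ∀ {t x} {u v : Word n t} → LastEdge G u v → LastEdge G (x ∷ u) (x ∷ v)

-- The generalized Sierpiński gasket S[G,t]: S(G,t) with all linking edges
-- contracted.
Gasket : ∀ {n} → SimpleGraph n → ℕ → QGraph
Gasket {n} G t = record
  { Carrier = Word n t
  ; _≈_     = EqClosure (LinkEdge G)
  ; _—_     = λ u v → ∃ λ u′ → ∃ λ v′ →
                EqClosure (LinkEdge G) u u′ × EqClosure (LinkEdge G) v v′ ×
                LastEdge G u′ v′
  }

{-# OPTIONS --safe #-}
module Submission where

-- Label a word of length s + 1 by its component in S[G, s+1].  The component
-- of a constant word x^{s+1} is determined by the component of x in G, since
-- x^{s+1} and y^{s+1} are joined whenever x y ∈ E(G); call these components
-- extreme and the others inner.  The copy x·S[G, s] of S[G, s] meets the rest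
-- of the gasket only at its extreme vertices x y^s, identified with y x^s for
-- y adjacent to x.  So of the extreme components of the copy, the one for the
-- component of x merges with that of x^{s+1}, while the other c − 1 become
-- inner components of S[G, s+1], together with the inner components of the
-- copy.  Hence k(t + 1) = c + n (k(t) − 1) with k(1) = c, and induction on t
-- gives the closed form.

open import Defs hiding (sym)
open import Data.Nat using (ℕ; zero; suc; _≤_; _+_; _*_; _∸_; _^_; s≤s)
open import Data.Nat.Properties
  using (*-identityʳ; *-assoc; +-cancelʳ-≡; m+n∸m≡n; m≤n⇒∃[o]m+o≡n)
open import Data.Nat.Tactic.RingSolver using (solve-∀)
open import Data.Fin using (Fin; fromℕ<; punchIn; punchOut; _≟_)
open import Data.Fin.Properties
  using (¬Fin0; +↔⊎; *↔×; injective⇒≤; punchIn-punchOut; punchOut-cong; punchOut-punchIn; punchInᵢ≢i)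
open import Data.Product using (∃; _×_; _,_; proj₁; proj₂)
open import Data.Product.Function.NonDependent.Propositional using (_×-↔_)
open import Data.Sum using (_⊎_; inj₁; inj₂)
open import Data.Sum.Function.Propositional using (_⊎-↔_)
open import Data.Vec using ([]; _∷_; replicate)
open import Data.Empty using (⊥-elim)
open import Function.Base using (_∘_)
open import Function.Bundles using (_↔_; _⇔_; Inverse; Injection; Equivalence; mk⇔)
open import Function.Properties.Inverse using (↔-refl; ↔-sym; ↔-trans; ↔⇒↣)
open import Relation.Nullary using (yes; no)
open import Relation.Binary.PropositionalEquality
  using (_≡_; refl; sym; trans; cong; subst; isEquivalence; module ≡-Reasoning)
open import Relation.Binary.Construct.Closure.Equivalence as EqClosure using (EqClosure)
open import Relation.Binary.Construct.Closure.ReflexiveTransitive using (ε; _◅◅_)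

numComponents-byLabelling :
  {Γ : QGraph} {L : Set} {k : ℕ}
  (label : Carrier Γ → L) (canonical : L → Carrier Γ) →
  (∀ l → label (canonical l) ≡ l) →
  (∀ a → Connected Γ a (canonical (label a))) →
  (∀ {a b} → Connected Γ a b → label a ≡ label b) →
  L ↔ Fin k → NumComponents Γ k
numComponents-byLabelling {Γ} label canonical label-canonical canonical-connected
  connected⇒sameLabel L↔Fin = to ∘ label , surjective , kernel
  where
  open Inverse L↔Fin

  surjective : ∀ i → ∃ λ a → to (label a) ≡ i
  surjective i = canonical (from i) , trans (cong to (label-canonical (from i))) (strictlyInverseˡ i)

  sameLabel⇒connected : ∀ {a b} → label a ≡ label b → Connected Γ a b
  sameLabel⇒connected {a} {b} eq =
    canonical-connected a ◅◅
    subst (λ l → Connected Γ (canonical l) b) (sym eq) (EqClosure.symmetric _ (canonical-connected b))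

  kernel : ∀ a b → (to (label a) ≡ to (label b)) ⇔ Connected Γ a b
  kernel a b = mk⇔ (sameLabel⇒connected ∘ Injection.injective (↔⇒↣ L↔Fin)) (cong to ∘ connected⇒sameLabel)

numComponents-≤ : ∀ {n c} (G : SimpleGraph n) → NumComponents (asQGraph G) c → c ≤ n
numComponents-≤ G (component , surjective , _) = injective⇒≤ representative-injective
  where
  representative-injective : ∀ {i j} → proj₁ (surjective i) ≡ proj₁ (surjective j) → i ≡ j
  representative-injective {i} {j} eq =
    trans (sym (proj₂ (surjective i))) (trans (cong component eq) (proj₂ (surjective j)))

innerCount : ℕ → ℕ → ℕ → ℕ
innerCount n c′ zero    = 0
innerCount n c′ (suc s) = n * (innerCount n c′ s + c′)

innerCount-closed : ∀ m c′ s → innerCount (suc m) c′ s * m + suc m * c′ ≡ suc m ^ suc s * c′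
innerCount-closed m c′ zero    = cong (_* c′) (sym (*-identityʳ (suc m)))
innerCount-closed m c′ (suc s) = begin
  suc m * (I + c′) * m + suc m * c′  ≡⟨ factor m c′ I ⟩
  suc m * (I * m + suc m * c′)       ≡⟨ cong (suc m *_) (innerCount-closed m c′ s) ⟩
  suc m * (suc m ^ suc s * c′)       ≡⟨ sym (*-assoc (suc m) (suc m ^ suc s) c′) ⟩
  suc m ^ suc (suc s) * c′           ∎
  where
  open ≡-Reasoning
  I = innerCount (suc m) c′ s
  factor : ∀ m c′ I → suc m * (I + c′) * m + suc m * c′ ≡ suc m * (I * m + suc m * c′)
  factor = solve-∀

componentCount-closed : ∀ {n c′} s → suc c′ ≤ n →
  (suc c′ + innerCount n c′ s) * (n ∸ 1) ≡ n ^ suc s * c′ + (n ∸ suc c′)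
componentCount-closed {suc m} {c′} s (s≤s c′≤m) with d , refl ← m≤n⇒∃[o]m+o≡n c′≤m
  rewrite m+n∸m≡n c′ d = +-cancelʳ-≡ (suc m * c′) _ _ (begin
    (suc c′ + I) * m + suc m * c′     ≡⟨ regroup c′ I m ⟩
    suc c′ * m + (I * m + suc m * c′)  ≡⟨ cong (suc c′ * m +_) (innerCount-closed m c′ s) ⟩
    suc c′ * m + X                     ≡⟨ expand c′ d X ⟩
    X + d + suc m * c′                 ∎)
  where
  open ≡-Reasoning
  I = innerCount (suc m) c′ s
  X = suc m ^ suc s * c′
  regroup : ∀ c′ I m → (suc c′ + I) * m + suc m * c′ ≡ suc c′ * m + (I * m + suc m * c′)
  regroup = solve-∀
  expand : ∀ c′ d X → suc c′ * (c′ + d) + X ≡ X + d + suc (c′ + d) * c′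
  expand = solve-∀

module GasketComponents {n c′ : ℕ} (G : SimpleGraph n)
  (components : NumComponents (asQGraph G) (suc c′)) where

  component : Fin n → Fin (suc c′)
  component = proj₁ components

  representative : Fin (suc c′) → Fin n
  representative D = proj₁ (proj₁ (proj₂ components) D)

  component-representative : ∀ D → component (representative D) ≡ D
  component-representative D = proj₂ (proj₁ (proj₂ components) D)

  sameComponent⇒connected : ∀ {x y} → component x ≡ component y → Connected (asQGraph G) x y
  sameComponent⇒connected = Equivalence.to (proj₂ (proj₂ components) _ _)

  adjacent⇒sameComponent : ∀ {x y} → Adj G x y → component x ≡ component y
  adjacent⇒sameComponent a = Equivalence.from (proj₂ (proj₂ components) _ _) (EqClosure.return (inj₂ a))

  GasketStep : ∀ t → Word n t → Word n t → Set
  GasketStep t u v = _≈_ (Gasket G t) u v ⊎ _—_ (Gasket G t) u v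

  infix 4 _~_
  _~_ : ∀ {t} → Word n t → Word n t → Set
  _~_ {t} = Connected (Gasket G t)

  ∷-connected : ∀ {t} x {u v : Word n t} → u ~ v → (x ∷ u) ~ (x ∷ v)
  ∷-connected {t} x = EqClosure.gmap (x ∷_) prefix-step
    where
    prefix-contracted : ∀ {u v : Word n t} →
      EqClosure (LinkEdge G) u v → EqClosure (LinkEdge G) (x ∷ u) (x ∷ v)
    prefix-contracted = EqClosure.gmap (x ∷_) there

    prefix-step : ∀ {u v} → GasketStep t u v → GasketStep (suc t) (x ∷ u) (x ∷ v)
    prefix-step (inj₁ e) = inj₁ (prefix-contracted e)
    prefix-step (inj₂ (u′ , v′ , e , f , edge)) =
      inj₂ (x ∷ u′ , x ∷ v′ , prefix-contracted e , prefix-contracted f , there edge)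

  replicate-adjacent : ∀ s {x y} → Adj G x y → replicate (suc s) x ~ replicate (suc s) y
  replicate-adjacent zero    a = EqClosure.return (inj₂ (_ , _ , ε , ε , last a))
  replicate-adjacent (suc s) {x} {y} a =
    ∷-connected x (replicate-adjacent s a) ◅◅
    EqClosure.return (inj₁ (EqClosure.return (here a))) ◅◅
    ∷-connected y (replicate-adjacent s a)

  replicate-sameComponent : ∀ s {x y} → component x ≡ component y →
    replicate (suc s) x ~ replicate (suc s) y
  replicate-sameComponent s =
    EqClosure.gfold (EqClosure.isEquivalence _) (replicate (suc s)) step ∘ sameComponent⇒connected
    where
    step : ∀ {x y} → x ≡ y ⊎ Adj G x y → replicate (suc s) x ~ replicate (suc s) y
    step (inj₁ refl) = ε
    step (inj₂ a)    = replicate-adjacent s a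

  ∷-replicate-connected : ∀ s {x y} → component x ≡ component y →
    (x ∷ replicate (suc s) y) ~ replicate (suc (suc s)) y
  ∷-replicate-connected s {x} eq =
    ∷-connected x (replicate-sameComponent s (sym eq)) ◅◅ replicate-sameComponent (suc s) eq

  -- An extreme component (inj₁) is named by the component of G of its
  -- constant words.  An inner component of S[G, s+1] lies in a copy x and is
  -- there either inner or extreme for a component D ≠ component x of G,
  -- coded by punchOut.
  Inner : ℕ → Set
  Inner zero    = Fin 0
  Inner (suc s) = Fin n × (Inner s ⊎ Fin c′)

  Label : ℕ → Set
  Label s = Fin (suc c′) ⊎ Inner s

  extend : ∀ {s} → Fin n → Label s → Label (suc s)
  extend x (inj₂ M) = inj₂ (x , inj₁ M)
  extend x (inj₁ D) with component x ≟ D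
  ... | yes _   = inj₁ D
  ... | no x∉D = inj₂ (x , inj₂ (punchOut x∉D))

  label : ∀ s → Word n (suc s) → Label s
  label zero    (x ∷ []) = inj₁ (component x)
  label (suc s) (x ∷ u)  = extend x (label s u)

  canonical : ∀ s → Label s → Word n (suc s)
  canonical s       (inj₁ D)             = replicate (suc s) (representative D)
  canonical (suc s) (inj₂ (x , inj₁ M)) = x ∷ canonical s (inj₂ M)
  canonical (suc s) (inj₂ (x , inj₂ P)) = x ∷ canonical s (inj₁ (punchIn (component x) P))

  extend-own : ∀ {s x D} → component x ≡ D → extend {s} x (inj₁ D) ≡ inj₁ D
  extend-own {x = x} {D} x∈D with component x ≟ D
  ... | yes _   = refl
  ... | no x∉D = ⊥-elim (x∉D x∈D)

  extend-other : ∀ {s} x P → extend {s} x (inj₁ (punchIn (component x) P)) ≡ inj₂ (x , inj₂ P)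
  extend-other x P with component x ≟ punchIn (component x) P
  ... | yes x∈D = ⊥-elim (punchInᵢ≢i (component x) P (sym x∈D))
  ... | no x∉D = cong (λ Q → inj₂ (x , inj₂ Q))
                   (trans (punchOut-cong (component x) refl) (punchOut-punchIn (component x)))

  label-replicate : ∀ s x → label s (replicate (suc s) x) ≡ inj₁ (component x)
  label-replicate zero    x = refl
  label-replicate (suc s) x = trans (cong (extend x) (label-replicate s x)) (extend-own refl)

  label-∷-replicate : ∀ s {x y} → component x ≡ component y →
    label (suc s) (x ∷ replicate (suc s) y) ≡ inj₁ (component x)
  label-∷-replicate s {x} {y} eq =
    trans (cong (extend x) (label-replicate s y)) (trans (extend-own eq) (cong inj₁ (sym eq)))

  label-canonical : ∀ s l → label s (canonical s l) ≡ l
  label-canonical s (inj₁ D) =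
    trans (label-replicate s (representative D)) (cong inj₁ (component-representative D))
  label-canonical (suc s) (inj₂ (x , inj₁ M)) = cong (extend x) (label-canonical s (inj₂ M))
  label-canonical (suc s) (inj₂ (x , inj₂ P)) =
    trans (cong (extend x) (label-canonical s (inj₁ _))) (extend-other x P)

  canonical-connected : ∀ s w → w ~ canonical s (label s w)
  canonical-connected zero (x ∷ []) =
    replicate-sameComponent zero (sym (component-representative (component x)))
  canonical-connected (suc s) (x ∷ u) with label s u | canonical-connected s u
  ... | inj₂ M | u~ = ∷-connected x u~
  ... | inj₁ D | u~ with component x ≟ D
  ...   | yes x∈D = ∷-connected x u~ ◅◅
                    ∷-replicate-connected s (trans x∈D (sym (component-representative D)))
  ...   | no x∉D  = ∷-connected x
                      (subst (λ D′ → u ~ canonical s (inj₁ D′)) (sym (punchIn-punchOut x∉D)) u~)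

  link-label : ∀ {s} {u v : Word n (suc s)} → LinkEdge G u v → label s u ≡ label s v
  link-label {suc s} (here a) =
    trans (label-∷-replicate s eq) (sym (trans (label-∷-replicate s (sym eq)) (cong inj₁ (sym eq))))
    where eq = adjacent⇒sameComponent a
  link-label {suc s} (there e) = cong (extend _) (link-label e)

  last-label : ∀ {s} {u v : Word n (suc s)} → LastEdge G u v → label s u ≡ label s v
  last-label (last a)          = cong inj₁ (adjacent⇒sameComponent a)
  last-label {suc s} (there e) = cong (extend _) (last-label e)

  connected⇒sameLabel : ∀ s {u v : Word n (suc s)} → u ~ v → label s u ≡ label s v
  connected⇒sameLabel s = EqClosure.gfold isEquivalence (label s) step
    where
    contracted : ∀ {u v} → EqClosure (LinkEdge G) u v → label s u ≡ label s v
    contracted = EqClosure.gfold isEquivalence (label s) link-label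

    step : ∀ {u v} → GasketStep (suc s) u v → label s u ≡ label s v
    step (inj₁ e)                    = contracted e
    step (inj₂ (_ , _ , e , f , edge)) = trans (contracted e) (trans (last-label edge) (sym (contracted f)))

  Inner↔Fin : ∀ s → Inner s ↔ Fin (innerCount n c′ s)
  Inner↔Fin zero    = ↔-refl
  Inner↔Fin (suc s) =
    ↔-trans (↔-refl ×-↔ ↔-trans (Inner↔Fin s ⊎-↔ ↔-refl) (↔-sym +↔⊎)) (↔-sym *↔×)

  Label↔Fin : ∀ s → Label s ↔ Fin (suc c′ + innerCount n c′ s)
  Label↔Fin s = ↔-trans (↔-refl ⊎-↔ Inner↔Fin s) (↔-sym +↔⊎)

  numComponents : ∀ s → NumComponents (Gasket G (suc s)) (suc c′ + innerCount n c′ s)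
  numComponents s = numComponents-byLabelling (label s) (canonical s)
    (label-canonical s) (canonical-connected s) (connected⇒sameLabel s) (Label↔Fin s)

mainTheorem7 : (n : ℕ) → 2 ≤ n → (G : SimpleGraph n) →
    (c : ℕ) → NumComponents (asQGraph G) c →
    (t : ℕ) → 1 ≤ t →
    ∃ λ k → NumComponents (Gasket G t) k ×
      k * (n ∸ 1) ≡ n ^ t * (c ∸ 1) + (n ∸ c)
mainTheorem7 n 2≤n G zero (component , _) t _ = ⊥-elim (¬Fin0 (component (fromℕ< 2≤n)))
mainTheorem7 n _ G (suc c′) components zero ()
mainTheorem7 n _ G (suc c′) components (suc s) _ =
  suc c′ + innerCount n c′ s ,
  GasketComponents.numComponents G components s ,
  componentCount-closed s (numComponents-≤ G components)
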